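{- For every graph $G$, the $\alpha$-degeneracy of $G$ is at most the tree-independence number of $G$.
   Context: Graphs are finite and simple; a graph is null if it has no vertices. The $\alpha$-degeneracy of $G$ is the smallest integer $k$ such that every non-null induced subgraph $H$ of $G$ contains a vertex $v$ with $\alpha(H[N_H[v]])\le k$, where $N_H[v]$ is the closed neighborhood of $v$ in $H$ and $\alpha$ the independence number. A tree-decomposition of $G$ is a pair $(T,\{B_t\}_{t\in V(T)})$ with $T$ a tree and bags $B_t\subseteq V(G)$ such that each vertex lies in a nonempty connected set of bags and each edge has both ends in some bag; its independence number is $\max_t\alpha(G[B_t])$, and the tree-independence number of $G$ is the minimum of this over all tree-decompositions of $G$. -}

module Defs where

open import Data.Nat using (ℕ; _≤_; _<_)
open import Data.Fin using (Fin)
open import Data.Fin.Subset using (Subset; _∈_; _⊆_; ∣_∣)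
open import Data.List using (List; []; _∷_; _++_; [_]; length)
open import Data.List.Relation.Unary.Linked using (Linked)
open import Data.List.Relation.Unary.Unique.Propositional using (Unique)
open import Data.Product using (Σ; ∃; ∃-syntax; _×_)
open import Data.Sum using (_⊎_)
open import Data.Unit using (⊤)
open import Relation.Nullary using (¬_)
open import Relation.Binary.PropositionalEquality using (_≡_)

record Graph : Set₁ where
  field
    n      : ℕ
    Adj    : Fin n → Fin n → Set
    sym    : ∀ {u v} → Adj u v → Adj v u
    irrefl : ∀ {u} → ¬ Adj u u

open Graph public

Independent : (G : Graph) → Subset (n G) → Set
Independent G I = ∀ u v → u ∈ I → v ∈ I → ¬ Adj G u v

αAtMost : (G : Graph) → (Fin (n G) → Set) → ℕ → Set
αAtMost G P k = ∀ (I : Subset (n G)) → (∀ u → u ∈ I → P u) → Independent G I → ∣ I ∣ ≤ k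

ClosedNbhdIn : (G : Graph) → Subset (n G) → Fin (n G) → Fin (n G) → Set
ClosedNbhdIn G S v u = u ∈ S × (u ≡ v ⊎ Adj G v u)

AlphaDegenerate : Graph → ℕ → Set
AlphaDegenerate G k =
  ∀ (S : Subset (n G)) → (∃[ w ] w ∈ S) →
  ∃[ v ] (v ∈ S × αAtMost G (ClosedNbhdIn G S v) k)

IsAlphaDegeneracy : Graph → ℕ → Set
IsAlphaDegeneracy G k = AlphaDegenerate G k × (∀ k′ → AlphaDegenerate G k′ → k ≤ k′)

data WalkIn (G : Graph) (P : Fin (n G) → Set) : Fin (n G) → Fin (n G) → Set where
  here : ∀ {x} → P x → WalkIn G P x x
  step : ∀ {x y z} → P x → Adj G x y → WalkIn G P y z → WalkIn G P x z

ConnectedSet : (G : Graph) → (Fin (n G) → Set) → Set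
ConnectedSet G P = (∃[ x ] P x) × (∀ x y → P x → P y → WalkIn G P x y)

HasCycle : Graph → Set
HasCycle G =
  ∃[ x ] ∃[ y ] Σ (List (Fin (n G))) λ ms →
    1 ≤ length ms ×
    Linked (Adj G) (x ∷ ms ++ [ y ]) ×
    Unique (x ∷ ms ++ [ y ]) ×
    Adj G y x

IsTree : Graph → Set
IsTree T = ConnectedSet T (λ _ → ⊤) × ¬ HasCycle T

record TreeDecomposition (G : Graph) : Set₁ where
  field
    T      : Graph
    isTree : IsTree T
    bag    : Fin (n T) → Subset (n G)
    vertex-connected : ∀ (v : Fin (n G)) → ConnectedSet T (λ t → v ∈ bag t)
    edge-covered     : ∀ u v → Adj G u v → ∃[ t ] (u ∈ bag t × v ∈ bag t)

open TreeDecomposition public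

IndNumAtMost : (G : Graph) → TreeDecomposition G → ℕ → Set
IndNumAtMost G D k = ∀ t → αAtMost G (λ u → u ∈ bag D t) k

IsTreeIndependenceNumber : Graph → ℕ → Set₁
IsTreeIndependenceNumber G k =
  (Σ (TreeDecomposition G) λ D → IndNumAtMost G D k) ×
  (∀ (D : TreeDecomposition G) k′ → IndNumAtMost G D k′ → k ≤ k′)

{-# OPTIONS --safe #-}
-- Fix a tree-decomposition of independence number k and a non-null S ⊆ V(G); with its bags
-- cut down to S it decomposes G[S].  Take a leaf ℓ of the decomposition tree: if every vertex
-- of S in the bag of ℓ also lies in another bag, deleting ℓ still leaves a decomposition of
-- G[S].  Otherwise some v ∈ S lies in the bag of ℓ only; every S-neighbour of v shares a bag
-- with v, hence lies in the bag of ℓ, so α(G[N_S[v]]) ≤ k.  Thus k bounds the α-degeneracy.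
module Submission where

open import Defs
open import Data.Nat using (ℕ; _≤_; _<_; s≤s; z≤n)
open import Data.Nat.Induction using (<-wellFounded)
open import Induction.WellFounded using (Acc; acc)
open import Data.Fin using (Fin; zero; suc; _≟_)
open import Data.Fin.Properties using (any?)
open import Data.Fin.Subset using (Subset; _∈_; _∉_; ∣_∣; _-_; ⊤; inside; outside)
open import Data.Fin.Subset.Properties using (_∈?_; ∈⊤; p─q⊆p; x∈p∧x≢y⇒x∈p-y; x∈p⇒∣p-x∣<∣p∣)
open import Data.List using (List; []; _∷_; _++_; [_])
open import Data.List.Properties using (++-assoc)
open import Data.List.Relation.Unary.Linked as Linked using (Linked; []; [-]; _∷_)
open import Data.List.Relation.Unary.AllPairs using (AllPairs; []; _∷_)
open import Data.List.Relation.Unary.All using (All; []; _∷_)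
import Data.List.Relation.Unary.All.Properties as All
open import Data.List.Relation.Unary.Any using (here; there)
open import Data.List.Relation.Unary.Unique.Propositional using (Unique)
open import Data.List.Membership.Propositional using () renaming (_∈_ to _∈ₗ_; _∉_ to _∉ₗ_)
open import Data.List.Membership.Propositional.Properties using (∈-∃++)
import Data.List.Membership.DecPropositional as DecMembership
open import Data.Vec using (_∷_)
open import Data.Vec.Base using () renaming (there to thereᵥ)
open import Data.Product using (∃; ∃-syntax; _×_; _,_; proj₁; proj₂)
open import Data.Sum using (_⊎_; inj₁; inj₂)
open import Data.Empty using (⊥-elim)
open import Data.Unit using (tt)
open import Function using (_∘_)
open import Relation.Binary using (Decidable)
open import Relation.Nullary using (¬_; Dec; yes; no)
open import Relation.Nullary.Decidable using (¬?; _×-dec_; decidable-stable)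
open import Relation.Binary.PropositionalEquality as ≡ using (_≡_; _≢_; refl; subst; cong)

module _ {n : ℕ} where
  open DecMembership (_≟_ {n}) public using () renaming (_∈?_ to _∈ₗ?_)

x∉p-x : ∀ {k} {x : Fin k} (p : Subset k) → x ∉ p - x
x∉p-x {x = zero}  (_ ∷ p) ()
x∉p-x {x = suc x} (inside  ∷ p) (thereᵥ x∈p-x) = x∉p-x p x∈p-x
x∉p-x {x = suc x} (outside ∷ p) (thereᵥ x∈p-x) = x∉p-x p x∈p-x

x∈p-y⇒x≢y : ∀ {k} {x y : Fin k} {p : Subset k} → x ∈ p - y → x ≢ y
x∈p-y⇒x≢y {p = p} x∈p-x refl = x∉p-x p x∈p-x

module _ {a r} {A : Set a} {R : A → A → Set r} where

  Linked-++⁻ˡ : ∀ xs {ys} → Linked R (xs ++ ys) → Linked R xs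
  Linked-++⁻ˡ []           _        = []
  Linked-++⁻ˡ (x ∷ [])     _        = [-]
  Linked-++⁻ˡ (x ∷ y ∷ xs) (r ∷ rs) = r ∷ Linked-++⁻ˡ (y ∷ xs) rs

  Linked-++⁻ʳ : ∀ xs {ys} → Linked R (xs ++ ys) → Linked R ys
  Linked-++⁻ʳ []       rs = rs
  Linked-++⁻ʳ (x ∷ xs) rs = Linked-++⁻ʳ xs (Linked.tail rs)

  AllPairs-++⁻ˡ : ∀ xs {ys} → AllPairs R (xs ++ ys) → AllPairs R xs
  AllPairs-++⁻ˡ []       _          = []
  AllPairs-++⁻ˡ (x ∷ xs) (px ∷ rs) = All.++⁻ˡ xs px ∷ AllPairs-++⁻ˡ xs rs

  AllPairs-++⁻ʳ : ∀ xs {ys} → AllPairs R (xs ++ ys) → AllPairs R ys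
  AllPairs-++⁻ʳ []       rs       = rs
  AllPairs-++⁻ʳ (x ∷ xs) (_ ∷ rs) = AllPairs-++⁻ʳ xs rs

SimplePath : (G : Graph) → List (Fin (n G)) → Set
SimplePath G xs = Linked (Adj G) xs × Unique xs

module _ {G : Graph} where

  SimplePath-++⁻ˡ : ∀ xs {ys} → SimplePath G (xs ++ ys) → SimplePath G xs
  SimplePath-++⁻ˡ xs (L , U) = Linked-++⁻ˡ xs L , AllPairs-++⁻ˡ xs U

  SimplePath-++⁻ʳ : ∀ xs {ys} → SimplePath G (xs ++ ys) → SimplePath G ys
  SimplePath-++⁻ʳ xs (L , U) = Linked-++⁻ʳ xs L , AllPairs-++⁻ʳ xs U

  WalkIn-map : ∀ {P Q : Fin (n G) → Set} → (∀ {z} → P z → Q z) →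
               ∀ {x y} → WalkIn G P x y → WalkIn G Q x y
  WalkIn-map f (here Px)       = here (f Px)
  WalkIn-map f (step Px x~y w) = step (f Px) x~y (WalkIn-map f w)

  WalkIn-source : ∀ {P : Fin (n G) → Set} {x y} → WalkIn G P x y → P x
  WalkIn-source (here Px)     = Px
  WalkIn-source (step Px _ _) = Px

  first-step : ∀ {P : Fin (n G) → Set} {x y} → WalkIn G P x y → x ≢ y → ∃[ q ] (Adj G x q × P q)
  first-step (here _)       x≢x = ⊥-elim (x≢x refl)
  first-step (step _ x~q w) _   = _ , x~q , WalkIn-source w

  -- Loop erasure: a repeated start vertex is cut off the path built for the rest of the walk.
  walk⇒simplePath : ∀ {P : Fin (n G) → Set} {x y} → WalkIn G P x y → x ≢ y →
                    ∃[ ms ] SimplePath G (x ∷ ms ++ [ y ])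
  walk⇒simplePath (here _) x≢x = ⊥-elim (x≢x refl)
  walk⇒simplePath {x = x} {y} (step {y = x₁} _ x~x₁ w) x≢y with x₁ ≟ y
  ... | yes refl = [] , x~x₁ ∷ [-] , (x≢y ∷ []) ∷ [] ∷ []
  ... | no x₁≢y with walk⇒simplePath w x₁≢y
  ...   | ms , L , U with x ∈ₗ? (x₁ ∷ ms)
  ...     | no x∉ = x₁ ∷ ms , x~x₁ ∷ L , All.++⁺ (All.¬Any⇒All¬ _ x∉) (x≢y ∷ []) ∷ U
  ...     | yes x∈ with ∈-∃++ x∈
  ...       | pre , post , eq = post , SimplePath-++⁻ʳ pre (subst (SimplePath G) split (L , U))
    where
    split : (x₁ ∷ ms) ++ [ y ] ≡ pre ++ x ∷ post ++ [ y ]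
    split = ≡.trans (cong (_++ [ y ]) eq) (++-assoc pre (x ∷ post) [ y ])

-- Constructively, adjacency in a tree is decidable: x ≢ y are adjacent iff the simple path
-- between them, which connectivity provides, has no interior vertex.
adj? : ∀ {T : Graph} → IsTree T → Decidable (Adj T)
adj? {T} ((_ , walk) , acyclic) x y with x ≟ y
... | yes refl = no (irrefl T)
... | no x≢y with walk⇒simplePath (walk x y tt tt) x≢y
...   | []           , x~y ∷ _ , _ = yes x~y
...   | ms@(_ ∷ _)   , L , U       = no λ x~y → acyclic (x , y , ms , s≤s z≤n , L , U , sym T x~y)

AtMostOneNeighbour : (H : Graph) → (Fin (n H) → Set) → Fin (n H) → Set
AtMostOneNeighbour H P ℓ = ∀ {y z} → P y → P z → Adj H ℓ y → Adj H ℓ z → y ≡ z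

LeafIn : (H : Graph) → Subset (n H) → Fin (n H) → Set
LeafIn H A ℓ = ℓ ∈ A × AtMostOneNeighbour H (_∈ A) ℓ

walk-avoiding : ∀ {H : Graph} {P : Fin (n H) → Set} {ℓ} → AtMostOneNeighbour H P ℓ →
                ∀ {x y} → x ≢ ℓ → y ≢ ℓ → WalkIn H P x y → WalkIn H (λ z → P z × z ≢ ℓ) x y
walk-avoiding uniq x≢ℓ y≢ℓ (here Px) = here (Px , x≢ℓ)
walk-avoiding {H} uniq {x} x≢ℓ y≢ℓ (step {y = x₁} Px x~x₁ w) with x₁ ≟ _
... | no x₁≢ℓ = step (Px , x≢ℓ) x~x₁ (walk-avoiding uniq x₁≢ℓ y≢ℓ w)
... | yes refl with w
...   | here _ = ⊥-elim (y≢ℓ refl)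
...   | step _ ℓ~x₂ w₂ with uniq (WalkIn-source w₂) Px ℓ~x₂ (sym H x~x₁)
...     | refl = walk-avoiding uniq x≢ℓ y≢ℓ w₂

module _ {T : Graph} (acyclic : ¬ HasCycle T) where

  path-start-neighbour-unique : ∀ {x ps} → SimplePath T (x ∷ ps) →
                                AtMostOneNeighbour T (_∈ₗ x ∷ ps) x
  path-start-neighbour-unique {ps = []} _ (here refl) _ x~x _ = ⊥-elim (irrefl T x~x)
  path-start-neighbour-unique {x} {p ∷ ps} path y∈ z∈ x~y x~z =
    ≡.trans (is-p y∈ x~y) (≡.sym (is-p z∈ x~z))
    where
    -- A neighbour of x further down the path would close a cycle.
    is-p : ∀ {w} → w ∈ₗ x ∷ p ∷ ps → Adj T x w → w ≡ p
    is-p (here refl)          x~x = ⊥-elim (irrefl T x~x)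
    is-p (there (here refl))  _   = refl
    is-p {w} (there (there w∈ps)) x~w with ∈-∃++ w∈ps
    ... | pre , post , eq =
      ⊥-elim (acyclic (x , w , p ∷ pre , s≤s z≤n , cycle .proj₁ , cycle .proj₂ , sym T x~w))
      where
      cycle : SimplePath T (x ∷ p ∷ pre ++ [ w ])
      cycle = SimplePath-++⁻ˡ {G = T} (x ∷ p ∷ pre ++ [ w ])
                (subst (λ qs → SimplePath T (x ∷ p ∷ qs))
                       (≡.trans eq (≡.sym (++-assoc pre [ w ] post))) path)

module _ {T : Graph} (tree : IsTree T) where

  -- Grow a simple path inside A at its start; once the start has no neighbour in A off the path,
  -- it is a leaf.  R contains the unvisited part of A and bounds the recursion.
  grow : ∀ {A : Subset (n T)} {x ps} (R : Subset (n T)) → Acc _<_ ∣ R ∣ →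
         SimplePath T (x ∷ ps) → All (_∈ A) (x ∷ ps) →
         (∀ {z} → z ∈ A → z ∉ₗ x ∷ ps → z ∈ R) → ∃ (LeafIn T A)
  grow {A} {x} {ps} R (acc smaller) (L , U) (x∈A ∷ ps⊆A) unvisited
    with any? (λ w → w ∈? A ×-dec adj? tree x w ×-dec ¬? (w ∈ₗ? x ∷ ps))
  ... | yes (w , w∈A , x~w , w∉) =
    grow (R - w) (smaller (x∈p⇒∣p-x∣<∣p∣ (unvisited w∈A w∉)))
         (sym T x~w ∷ L , All.¬Any⇒All¬ _ w∉ ∷ U) (w∈A ∷ x∈A ∷ ps⊆A)
         (λ z∈A z∉ → x∈p∧x≢y⇒x∈p-y (unvisited z∈A (z∉ ∘ there)) (z∉ ∘ here))
  ... | no no-fresh = x , x∈A , λ y∈A z∈A x~y x~z →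
    path-start-neighbour-unique {T = T} (proj₂ tree) (L , U)
      (on-path y∈A x~y) (on-path z∈A x~z) x~y x~z
    where
    on-path : ∀ {y} → y ∈ A → Adj T x y → y ∈ₗ x ∷ ps
    on-path {y} y∈A x~y = decidable-stable (y ∈ₗ? x ∷ ps) (λ y∉ → no-fresh (y , y∈A , x~y , y∉))

  ∃-leaf : ∀ {A x} → x ∈ A → ∃ (LeafIn T A)
  ∃-leaf {A} x∈A = grow A (<-wellFounded _) ([-] , [] ∷ []) (x∈A ∷ []) (λ z∈A _ → z∈A)

module _ {G : Graph} (D : TreeDecomposition G) (S : Subset (n G)) where

  record InducedDecomposition (A : Subset (n (T D))) : Set where
    field
      covers       : ∀ {v} → v ∈ S → ∃[ x ] (x ∈ A × v ∈ bag D x)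
      connects     : ∀ {v} → v ∈ S → ∀ {x y} → x ∈ A → y ∈ A → v ∈ bag D x → v ∈ bag D y →
                     WalkIn (T D) (λ z → z ∈ A × v ∈ bag D z) x y
      covers-edges : ∀ {u v} → u ∈ S → v ∈ S → Adj G u v → ∃[ x ] (x ∈ A × u ∈ bag D x × v ∈ bag D x)

  open InducedDecomposition

  induced-whole : InducedDecomposition ⊤
  induced-whole .covers {v} _ with vertex-connected D v
  ... | (x , v∈Bx) , _ = x , ∈⊤ , v∈Bx
  induced-whole .connects {v} _ {x} {y} _ _ v∈Bx v∈By =
    WalkIn-map (∈⊤ ,_) (proj₂ (vertex-connected D v) x y v∈Bx v∈By)
  induced-whole .covers-edges _ _ u~v with edge-covered D _ _ u~v
  ... | x , u∈Bx , v∈Bx = x , ∈⊤ , u∈Bx , v∈Bx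

  InOtherBag : Subset (n (T D)) → Fin (n (T D)) → Fin (n G) → Set
  InOtherBag A ℓ v = ∃[ x ] (x ∈ A - ℓ × v ∈ bag D x)

  module _ {A : Subset (n (T D))} {ℓ : Fin (n (T D))} (I : InducedDecomposition A) where

    closedNbhd⊆bag : ∀ {v} → v ∈ S → v ∈ bag D ℓ → ¬ InOtherBag A ℓ v →
                     ∀ u → ClosedNbhdIn G S v u → u ∈ bag D ℓ
    closedNbhd⊆bag _ v∈Bℓ _ _ (_ , inj₁ refl) = v∈Bℓ
    closedNbhd⊆bag v∈S _ only-ℓ _ (u∈S , inj₂ v~u) with covers-edges I v∈S u∈S v~u
    ... | x , x∈A , v∈Bx , u∈Bx with x ≟ ℓ
    ...   | yes refl = u∈Bx
    ...   | no x≢ℓ = ⊥-elim (only-ℓ (x , x∈p∧x≢y⇒x∈p-y x∈A x≢ℓ , v∈Bx))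

    module _ (leaf : LeafIn (T D) A ℓ) (shared : ∀ {v} → v ∈ S → v ∈ bag D ℓ → InOtherBag A ℓ v) where

      neighbour-bag : ∀ {v} → v ∈ S → v ∈ bag D ℓ → ∃[ q ] (Adj (T D) ℓ q × (q ∈ A × v ∈ bag D q))
      neighbour-bag v∈S v∈Bℓ with shared v∈S v∈Bℓ
      ... | x , x∈A-ℓ , v∈Bx = first-step (connects I v∈S (proj₁ leaf) (p─q⊆p A _ x∈A-ℓ) v∈Bℓ v∈Bx)
                                          (x∈p-y⇒x≢y x∈A-ℓ ∘ ≡.sym)

      remove-leaf : InducedDecomposition (A - ℓ)
      remove-leaf .covers v∈S with covers I v∈S
      ... | x , x∈A , v∈Bx with x ≟ ℓ
      ...   | yes refl = shared v∈S v∈Bx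
      ...   | no x≢ℓ = x , x∈p∧x≢y⇒x∈p-y x∈A x≢ℓ , v∈Bx
      remove-leaf .connects v∈S x∈A-ℓ y∈A-ℓ v∈Bx v∈By =
        WalkIn-map (λ ((z∈A , v∈Bz) , z≢ℓ) → x∈p∧x≢y⇒x∈p-y z∈A z≢ℓ , v∈Bz)
          (walk-avoiding (λ (y∈A , _) (z∈A , _) → proj₂ leaf y∈A z∈A)
            (x∈p-y⇒x≢y x∈A-ℓ) (x∈p-y⇒x≢y y∈A-ℓ)
            (connects I v∈S (p─q⊆p A _ x∈A-ℓ) (p─q⊆p A _ y∈A-ℓ) v∈Bx v∈By))
      remove-leaf .covers-edges u∈S v∈S u~v with covers-edges I u∈S v∈S u~v
      ... | x , x∈A , u∈Bx , v∈Bx with x ≟ ℓ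
      ...   | no x≢ℓ = x , x∈p∧x≢y⇒x∈p-y x∈A x≢ℓ , u∈Bx , v∈Bx
      ...   | yes refl with neighbour-bag u∈S u∈Bx | neighbour-bag v∈S v∈Bx
      ...     | q , ℓ~q , q∈A , u∈Bq | q′ , ℓ~q′ , q′∈A , v∈Bq′
        with proj₂ leaf q∈A q′∈A ℓ~q ℓ~q′
      ...       | refl = q , x∈p∧x≢y⇒x∈p-y q∈A (λ { refl → irrefl (T D) ℓ~q }) , u∈Bq , v∈Bq′

  inOtherBag? : ∀ A ℓ v → Dec (InOtherBag A ℓ v)
  inOtherBag? A ℓ v = any? (λ x → x ∈? A - ℓ ×-dec v ∈? bag D x)

  private-or-shared : ∀ A ℓ → (∃[ v ] (v ∈ S × v ∈ bag D ℓ × ¬ InOtherBag A ℓ v)) ⊎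
                              (∀ {v} → v ∈ S → v ∈ bag D ℓ → InOtherBag A ℓ v)
  private-or-shared A ℓ with any? (λ v → v ∈? S ×-dec v ∈? bag D ℓ ×-dec ¬? (inOtherBag? A ℓ v))
  ... | yes private-vertex = inj₁ private-vertex
  ... | no none = inj₂ λ {v} v∈S v∈Bℓ →
    decidable-stable (inOtherBag? A ℓ v) (λ ¬shared → none (v , v∈S , v∈Bℓ , ¬shared))

  ∃-closedNbhd⊆bag : ∀ {A} → Acc _<_ ∣ A ∣ → InducedDecomposition A → ∀ {w} → w ∈ S →
                     ∃[ v ] (v ∈ S × ∃[ x ] (∀ u → ClosedNbhdIn G S v u → u ∈ bag D x))
  ∃-closedNbhd⊆bag {A} (acc smaller) I w∈S with covers I w∈S
  ... | _ , x₀∈A , _ with ∃-leaf (isTree D) x₀∈A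
  ...   | ℓ , leaf with private-or-shared A ℓ
  ...     | inj₁ (v , v∈S , v∈Bℓ , only-ℓ) = v , v∈S , ℓ , closedNbhd⊆bag I v∈S v∈Bℓ only-ℓ
  ...     | inj₂ shared =
    ∃-closedNbhd⊆bag (smaller (x∈p⇒∣p-x∣<∣p∣ (proj₁ leaf))) (remove-leaf I leaf shared) w∈S

indNumAtMost⇒alphaDegenerate : ∀ {G k} (D : TreeDecomposition G) →
                               IndNumAtMost G D k → AlphaDegenerate G k
indNumAtMost⇒alphaDegenerate D α[B]≤k S (w , w∈S)
  with ∃-closedNbhd⊆bag D S (<-wellFounded _) (induced-whole D S) w∈S
... | v , v∈S , x , N[v]⊆Bx =
  v , v∈S , λ I I⊆N[v] independent → α[B]≤k x I (λ u u∈I → N[v]⊆Bx u (I⊆N[v] u u∈I)) independent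

lemma2p2 : ∀ (G : Graph) (a t : ℕ) →
    IsAlphaDegeneracy G a → IsTreeIndependenceNumber G t → a ≤ t
lemma2p2 G a t (_ , a-minimal) ((D , α[B]≤t) , _) =
  a-minimal t (indNumAtMost⇒alphaDegenerate D α[B]≤t)
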